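{- Let $p$ be an odd prime and let $\beta_1,\beta_2\in\mathcal{B}_R(p)$ satisfy $\beta_1=p-\beta_2^*$. Then $\beta_1,\beta_2\in\mathcal{B}_1(p)$ and $\beta_1=\beta_2$.
   Context: For $1\le\beta\le p-1$, $\beta^*$ denotes the unique integer $1\le\beta^*\le p-1$ with $\beta\beta^*\equiv1\pmod p$. Define $\mathcal{B}_1(p)=\{\beta:1\le\beta\le (p-3)/2,\ \beta+\beta^*\ge p,\ \beta^*\le 2\beta\}$, $\mathcal{B}_3(p)=\{\beta:1\le\beta\le(p-3)/2,\ p\le 2\beta+\beta^*,\ \beta\ge\beta^*\}$, and $\mathcal{B}_R(p)=\mathcal{B}_1(p)\cup\mathcal{B}_3(p)$. -}

module Defs where

open import Data.Nat using (ℕ; zero; suc; _+_; _*_; _∸_; _≤_; _<_; _≟_)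
open import Data.Nat.DivMod using (_%_)
open import Data.Nat.Primality using (Prime)
open import Data.Product using (_×_)
open import Data.Sum using (_⊎_)
open import Relation.Binary.PropositionalEquality using (_≡_)
open import Relation.Nullary using (yes; no)

-- Bounded search: the least b with k ≤ b < k + fuel and β * b ≡ 1 (mod p);
-- returns 0 if there is none.
searchInv : (p : ℕ) .{{_ : Data.Nat.NonZero p}} → ℕ → ℕ → ℕ → ℕ
searchInv p β k zero = 0
searchInv p β k (suc fuel) with (β * k) % p ≟ 1
... | yes _ = k
... | no  _ = searchInv p β (suc k) fuel

-- β* : the integer 1 ≤ β* ≤ p-1 with β β* ≡ 1 (mod p)
-- (unique when p is prime and 1 ≤ β ≤ p-1).
inv : (p : ℕ) .{{_ : Data.Nat.NonZero p}} → ℕ → ℕ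
inv p β = searchInv p β 1 (p ∸ 1)

-- B₁(p) = {β : 1 ≤ β ≤ (p-3)/2, β + β* ≥ p, β* ≤ 2β}
-- (for odd p, β ≤ (p-3)/2 is written 2β + 3 ≤ p)
B₁ : (p : ℕ) .{{_ : Data.Nat.NonZero p}} → ℕ → Set
B₁ p β = (1 ≤ β) × (2 * β + 3 ≤ p) × (p ≤ β + inv p β) × (inv p β ≤ 2 * β)

B₃ : (p : ℕ) .{{_ : Data.Nat.NonZero p}} → ℕ → Set
B₃ p β = (1 ≤ β) × (2 * β + 3 ≤ p) × (p ≤ 2 * β + inv p β) × (inv p β ≤ β)

B-R : (p : ℕ) .{{_ : Data.Nat.NonZero p}} → ℕ → Set
B-R p β = B₁ p β ⊎ B₃ p β

module Submission where

-- Write β* for `inv p β`.  The hypothesis β₁ = p - β₂* says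
-- β₂* + β₁ = p, i.e. β₁ ≡ -β₂* (mod p).  Inverting, β₁* ≡ -β₂ (mod p), and
-- since 0 < β₁* + β₂ < 2p this forces the symmetric relation β₁* + β₂ = p.
-- Both elements lie below p/2, so β₁ + β₂ < p.  Now
--   * membership in B₃ would give β* ≤ β, hence p = β* + β' ≤ β + β' < p
--     (β' the partner); so both β₁ and β₂ lie in B₁;
--   * membership in B₁ gives p ≤ β + β*, hence β' ≤ β for the partner β';
--     applied both ways this yields β₁ = β₂.

open import Defs
open import Data.Nat using (ℕ; _∸_; NonZero)
open import Data.Nat.Primality using (Prime)
open import Data.Product using (_×_)
open import Relation.Binary.PropositionalEquality using (_≡_; _≢_)

open import Data.Nat using (zero; suc; _+_; _*_; _≤_; _<_; _≟_; z<s; _%_; _/_; >-nonZero⁻¹)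
open import Data.Nat.Properties
open import Data.Nat.DivMod using (%-distribˡ-+; %-distribˡ-*; m%n%n≡m%n; m*n%n≡0; m≡m%n+[m/n]*n)
open import Data.Product using (_,_; proj₂)
open import Data.Sum using (inj₁; inj₂)
open import Data.Empty using (⊥-elim)
open import Relation.Nullary using (yes; no)
open import Relation.Binary.PropositionalEquality using (refl; sym; trans; cong; cong₂; subst; module ≡-Reasoning)
open import Data.Nat.Solver using (module +-*-Solver)
open +-*-Solver using (solve; _:+_; _:*_; _:=_)

searchInv-spec : ∀ p .{{_ : NonZero p}} β k fuel → 0 < searchInv p β k fuel →
  ((β * searchInv p β k fuel) % p ≡ 1) × (searchInv p β k fuel < k + fuel)
searchInv-spec p β k (suc fuel) found with (β * k) % p ≟ 1
... | yes isInv = isInv , m<m+n k z<s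
... | no _ with searchInv-spec p β (suc k) fuel found
...   | isInv , bound = isInv , subst (searchInv p β (suc k) fuel <_) (sym (+-suc k fuel)) bound

inv-spec : ∀ p .{{_ : NonZero p}} β → 0 < inv p β →
  ((β * inv p β) % p ≡ 1) × (inv p β < p)
inv-spec p β found with searchInv-spec p β 1 (p ∸ 1) found
... | isInv , bound = isInv , subst (inv p β <_) (m+[n∸m]≡n (>-nonZero⁻¹ p)) bound

drop-unit : ∀ p .{{_ : NonZero p}} u x → u % p ≡ 1 → (u * x) % p ≡ x % p
drop-unit p u x u≡1 = begin
  (u * x) % p             ≡⟨ %-distribˡ-* u x p ⟩
  ((u % p) * (x % p)) % p ≡⟨ cong (λ r → (r * (x % p)) % p) u≡1 ⟩
  (x % p + 0) % p         ≡⟨ cong (_% p) (+-identityʳ (x % p)) ⟩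
  x % p % p               ≡⟨ m%n%n≡m%n x p ⟩
  x % p                   ∎
  where open ≡-Reasoning

-- If c ≡ -b₁ (mod p), c is an inverse of b₂ and d an inverse of b₁, then
-- d ≡ -b₂ (mod p): negation commutes with inversion.
inverse-of-negation : ∀ p .{{_ : NonZero p}} b₁ b₂ c d → c + b₁ ≡ p →
  (b₂ * c) % p ≡ 1 → (b₁ * d) % p ≡ 1 → (d + b₂) % p ≡ 0
inverse-of-negation p b₁ b₂ c d c+b₁≡p b₂c≡1 b₁d≡1 = begin
  (d + b₂) % p                                  ≡⟨ %-distribˡ-+ d b₂ p ⟩
  (d % p + b₂ % p) % p                          ≡⟨ cong₂ (λ x y → (x + y) % p)
                                                     (sym (drop-unit p (b₂ * c) d b₂c≡1))
                                                     (sym (drop-unit p (b₁ * d) b₂ b₁d≡1)) ⟩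
  ((b₂ * c * d) % p + (b₁ * d * b₂) % p) % p    ≡⟨ sym (%-distribˡ-+ (b₂ * c * d) (b₁ * d * b₂) p) ⟩
  (b₂ * c * d + b₁ * d * b₂) % p                ≡⟨ cong (_% p) (regroup b₁ b₂ c d) ⟩
  (b₂ * d * (c + b₁)) % p                       ≡⟨ cong (λ x → (b₂ * d * x) % p) c+b₁≡p ⟩
  (b₂ * d * p) % p                              ≡⟨ m*n%n≡0 (b₂ * d) p ⟩
  0                                             ∎
  where
  open ≡-Reasoning
  regroup : ∀ b₁ b₂ c d → b₂ * c * d + b₁ * d * b₂ ≡ b₂ * d * (c + b₁)
  regroup = solve 4 (λ b₁ b₂ c d → b₂ :* c :* d :+ b₁ :* d :* b₂ := b₂ :* d :* (c :+ b₁)) refl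

multiple-below-2p : ∀ p .{{_ : NonZero p}} m → 0 < m → m < p + p → m % p ≡ 0 → m ≡ p
multiple-below-2p p m m>0 m<2p m%p≡0 with m / p | m≡m%n+[m/n]*n m p
... | zero        | m≡ = ⊥-elim (<⇒≢ m>0 (sym (trans m≡ (cong (_+ 0) m%p≡0))))
... | suc zero    | m≡ = trans m≡ (trans (cong (_+ (p + 0)) m%p≡0) (+-identityʳ p))
... | suc (suc k) | m≡ = ⊥-elim (<⇒≱ m<2p (subst (p + p ≤_) (sym (trans m≡ (cong (_+ _) m%p≡0)))
                                                      (+-monoʳ-≤ p (m≤m+n p (k * p)))))

sum-below : ∀ a b p → 2 * a + 3 ≤ p → 2 * b + 3 ≤ p → a + b < p
sum-below a b p 2a+3≤p 2b+3≤p = *-cancelˡ-< 2 (a + b) p (begin-strict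
  2 * (a + b)             ≡⟨ *-distribˡ-+ 2 a b ⟩
  2 * a + 2 * b           <⟨ +-mono-< (m<m+n (2 * a) z<s) (m<m+n (2 * b) z<s) ⟩
  (2 * a + 3) + (2 * b + 3) ≤⟨ +-mono-≤ 2a+3≤p 2b+3≤p ⟩
  p + p                   ≡⟨ cong (p +_) (sym (+-identityʳ p)) ⟩
  2 * p                   ∎)
  where open ≤-Reasoning

B-R-bounds : ∀ p .{{_ : NonZero p}} β → B-R p β →
  (1 ≤ β) × (2 * β + 3 ≤ p) × (p ≤ 2 * β + inv p β)
B-R-bounds p β (inj₁ (β≥1 , β≤ , p≤β+β* , _)) =
  β≥1 , β≤ , ≤-trans p≤β+β* (+-monoˡ-≤ (inv p β) (m≤m+n β (β + 0)))
B-R-bounds p β (inj₂ (β≥1 , β≤ , p≤2β+β* , _)) = β≥1 , β≤ , p≤2β+β*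

-- For β ∈ B-R the search for β* succeeds: β* = 0 would give p ≤ 2β < p.
B-R⇒inv>0 : ∀ p .{{_ : NonZero p}} β → B-R p β → 0 < inv p β
B-R⇒inv>0 p β β∈B with B-R-bounds p β β∈B
... | _ , β≤ , p≤2β+β* = n≢0⇒n>0 λ β*≡0 → <⇒≱ (2β<p β*≡0) p≤2β+β*
  where
  2β<p : inv p β ≡ 0 → 2 * β + inv p β < p
  2β<p β*≡0 = subst (λ x → 2 * β + x < p) (sym β*≡0) (<-≤-trans (+-monoʳ-< (2 * β) z<s) β≤)

B-R⇒B₁ : ∀ p .{{_ : NonZero p}} β β' → β + β' < p → inv p β + β' ≡ p → B-R p β → B₁ p β
B-R⇒B₁ p β β' small _ (inj₁ β∈B₁) = β∈B₁
B-R⇒B₁ p β β' small β*+β'≡p (inj₂ (_ , _ , _ , β*≤β)) =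
  ⊥-elim (<⇒≱ small (subst (_≤ β + β') β*+β'≡p (+-monoˡ-≤ β' β*≤β)))

-- If β ∈ B₁ and β* + β' = p, then β' ≤ β, because p ≤ β + β*.
B₁⇒partner≤ : ∀ p .{{_ : NonZero p}} β β' → inv p β + β' ≡ p → B₁ p β → β' ≤ β
B₁⇒partner≤ p β β' β*+β'≡p (_ , _ , p≤β+β* , _) = +-cancelˡ-≤ (inv p β) β' β (begin
  inv p β + β' ≡⟨ β*+β'≡p ⟩
  p            ≤⟨ p≤β+β* ⟩
  β + inv p β  ≡⟨ +-comm β (inv p β) ⟩
  inv p β + β  ∎)
  where open ≤-Reasoning

partner-symmetric : ∀ p .{{_ : NonZero p}} β₁ β₂ → B-R p β₁ → B-R p β₂ →
  inv p β₂ + β₁ ≡ p → inv p β₁ + β₂ ≡ p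
partner-symmetric p β₁ β₂ β₁∈B β₂∈B β₂*+β₁≡p with inv-spec p β₁ (B-R⇒inv>0 p β₁ β₁∈B)
                                                | inv-spec p β₂ (B-R⇒inv>0 p β₂ β₂∈B)
... | β₁β₁*≡1 , β₁*<p | β₂β₂*≡1 , _ = multiple-below-2p p (inv p β₁ + β₂)
  (≤-trans β₂≥1 (m≤n+m β₂ (inv p β₁)))
  (+-mono-<-≤ β₁*<p (<⇒≤ β₂<p))
  (inverse-of-negation p β₁ β₂ (inv p β₂) (inv p β₁) β₂*+β₁≡p β₂β₂*≡1 β₁β₁*≡1)
  where
  β₂≥1 : 1 ≤ β₂
  β₂≥1 with B-R-bounds p β₂ β₂∈B
  ... | β₂≥1 , _ = β₂≥1
  β₂<p : β₂ < p
  β₂<p with B-R-bounds p β₂ β₂∈B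
  ... | _ , β₂≤ , _ = <-≤-trans (m<m+n β₂ z<s) (≤-trans (+-monoˡ-≤ 3 (m≤m+n β₂ (β₂ + 0))) β₂≤)

proposition2 : (p : ℕ) → .{{_ : NonZero p}} → Prime p → p ≢ 2 →
    (β₁ β₂ : ℕ) → B-R p β₁ → B-R p β₂ → β₁ ≡ p ∸ inv p β₂ →
    B₁ p β₁ × B₁ p β₂ × β₁ ≡ β₂
proposition2 p _ _ β₁ β₂ β₁∈B β₂∈B β₁≡p-β₂* =
  β₁∈B₁ , β₂∈B₁ , ≤-antisym (B₁⇒partner≤ p β₂ β₁ β₂*+β₁≡p β₂∈B₁)
                            (B₁⇒partner≤ p β₁ β₂ β₁*+β₂≡p β₁∈B₁)
  where
  β₂*+β₁≡p : inv p β₂ + β₁ ≡ p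
  β₂*+β₁≡p = trans (cong (inv p β₂ +_) β₁≡p-β₂*)
                   (m+[n∸m]≡n (<⇒≤ (proj₂ (inv-spec p β₂ (B-R⇒inv>0 p β₂ β₂∈B)))))
  β₁*+β₂≡p : inv p β₁ + β₂ ≡ p
  β₁*+β₂≡p = partner-symmetric p β₁ β₂ β₁∈B β₂∈B β₂*+β₁≡p
  β₁+β₂<p : β₁ + β₂ < p
  β₁+β₂<p with B-R-bounds p β₁ β₁∈B | B-R-bounds p β₂ β₂∈B
  ... | _ , β₁≤ , _ | _ , β₂≤ , _ = sum-below β₁ β₂ p β₁≤ β₂≤
  β₁∈B₁ : B₁ p β₁
  β₁∈B₁ = B-R⇒B₁ p β₁ β₂ β₁+β₂<p β₁*+β₂≡p β₁∈B
  β₂∈B₁ : B₁ p β₂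
  β₂∈B₁ = B-R⇒B₁ p β₂ β₁ (subst (_< p) (+-comm β₁ β₂) β₁+β₂<p) β₂*+β₁≡p β₂∈B
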